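{- (1) If $v$ is a value of $\lambda_\rho$, then there is no term $t$ and no $p$ such that $v\to_p t$. (2) If $v$ is a $\circ$-value of $\lambda_\rho^\circ$, then there is no term $t$ such that $v\to t$.
   Context: Calculus $\lambda_\rho$. Terms: $t::=x\mid\lambda x.t\mid tt\mid\rho^n\mid U^nt\mid\pi^nt\mid t\otimes t\mid(b^m,\rho^n)\mid\mathsf{letcase}\ x=r\ \mathsf{in}\ \{t_0,\dots,t_{2^m-1}\}$ ($m\le n$ naturals; $\rho^n$ a density matrix on $n$ qubits, i.e. positive $2^n\times2^n$ matrix of trace 1; $0\le b^m<2^m$; $U^n$ a $2^n\times2^n$ unitary; $\pi^n=\{\pi_0,\dots,\pi_{2^n-1}\}$ the computational-basis measurement; $x$ bound in $\lambda x.t$ and the branches). For $m\le n$: $\overline{U^m}=U^m\otimes I^{n-m}$, $\overline{\pi_i}=\pi_i\otimes I^{n-m}$. Reduction $\to_p$: $(\lambda x.t)r\to_1t[r/x]$; $U^m\rho^n\to_1\overline{U^m}\rho^n\overline{U^m}^\dagger$; $\pi^m\rho^n\to_{p_i}(i,\rho_i^n)$ with $p_i=\mathrm{tr}(\overline{\pi_i}^\dagger\overline{\pi_i}\rho^n)$, $\rho^n_i=\overline{\pi_i}\rho^n\overline{\pi_i}^\dagger/p_i$; $\rho\otimes\rho'\to_1$ the Kronecker product matrix (both factors being density-matrix constants); $\mathsf{letcase}\ x=(b^m,\rho^n)\ \mathsf{in}\ \{t_0,\dots\}\to_1t_{b^m}[\rho^n/x]$; congruence (same $p$) under $\lambda$,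 on either side of an application, under $U^n$, under $\pi^n$, on either side of $\otimes$, and in the scrutinee of letcase. Values of $\lambda_\rho$: $w::=x\mid\lambda x.v\mid w\otimes w$, $v::=w\mid\rho^n\mid(b^m,\rho^n)$. Calculus $\lambda_\rho^\circ$: same terms except $(b^m,\rho^n)$ removed, letcase written $\mathsf{letcase}^\circ$, and sums $\sum_{i=1}^kp_it_i$ ($p_i\in(0,1]$, $\sum_ip_i=1$, modulo associativity/commutativity) added. Reduction $\to$: $(\lambda x.t)r\to t[r/x]$; $\mathsf{letcase}^\circ\ x=\pi^m\rho^n\ \mathsf{in}\ \{t_0,\dots\}\to\sum_ip_it_i[\rho^n_i/x]$; $U^m\rho^n\to\overline{U^m}\rho^n\overline{U^m}^\dagger$; $\rho\otimes\rho'\to$ Kronecker product; $\sum_ip_i\rho_i\to$ the matrix $\sum_ip_i\rho_i$; $\sum_ip_it\to t$ (a sum all of whose summands are the same term); $(\sum_ip_it_i)r\to\sum_ip_i(t_ir)$; congruences as for $\lambda_\rho$ plus $\sum_ip_it_i\to\sum_ip_ir_i$ if $t_j\to r_j$ for one $j$ and $t_i=r_i$ otherwise. $\circ$-values: $w::=x\mid\lambda x.v\mid w\otimes w\mid\sum_ip_iw_i$ (with $w_i\ne w_j$ for $i\ne j$), $v::=w\mid\rho^n$. -}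

module Defs where

open import Data.Nat using (ℕ; zero; suc; _≤_; _^_)
open import Data.Fin using (Fin; zero; suc)
open import Data.Product using (Σ; _×_; _,_; proj₁; proj₂)
open import Relation.Binary.PropositionalEquality using (_≡_; _≢_)

-- Agda's standard library has no complex numbers / matrices, so the
-- calculi are parametrised by the matrix-level data they manipulate:
--   Dens n  : density matrices on n qubits (2^n × 2^n, positive, trace 1)
--   Unit n  : 2^n × 2^n unitaries
--   Prob    : probabilities (reals in (0,1])
-- and the operations the reduction rules compute with.

record QStruct : Set₁ where
  field
    Dens  : ℕ → Set
    Unit  : ℕ → Set
    Prob  : Set
    one   : Prob
    -- U^m ρ^n ↦ (U^m ⊗ I^{n-m}) ρ^n (U^m ⊗ I^{n-m})†   (m ≤ n)
    applyU : ∀ {m n} → m ≤ n → Unit m → Dens n → Dens n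
    kron  : ∀ {n n'} → Dens n → Dens n' → Dens (n Data.Nat.+ n')
    -- the outcomes of measuring the first m qubits of ρ^n (m ≤ n) in the
    -- computational basis that have nonzero probability:
    -- (suc k) outcomes, the j-th being (p_i , i , ρ_i)
    measure : ∀ {m n} → m ≤ n → Dens n →
              Σ ℕ λ k → (Fin (suc k) → Prob × Fin (2 ^ m) × Dens n)
    -- convex combination  Σ_i p_i ρ_i  of (suc k) density matrices
    mix   : ∀ {n k} → (Fin (suc k) → Prob) → (Fin (suc k) → Dens n) → Dens n

extR : ∀ {Γ Δ} → (Fin Γ → Fin Δ) → Fin (suc Γ) → Fin (suc Δ)
extR r zero    = zero
extR r (suc i) = suc (r i)

module LambdaRho (Q : QStruct) where
  open QStruct Q

  -- terms with Γ free variables (de Bruijn); the letcase branches are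
  -- indexed by Fin (2^m) and bind one variable
  data Tm (Γ : ℕ) : Set where
    var     : Fin Γ → Tm Γ
    lam     : Tm (suc Γ) → Tm Γ
    app     : Tm Γ → Tm Γ → Tm Γ
    dens    : ∀ {n} → Dens n → Tm Γ
    uni     : ∀ {n} → Unit n → Tm Γ → Tm Γ
    meas    : (n : ℕ) → Tm Γ → Tm Γ
    tens    : Tm Γ → Tm Γ → Tm Γ
    pair    : ∀ {m n} → m ≤ n → Fin (2 ^ m) → Dens n → Tm Γ
    letcase : (m : ℕ) → Tm Γ → (Fin (2 ^ m) → Tm (suc Γ)) → Tm Γ

  ren : ∀ {Γ Δ} → (Fin Γ → Fin Δ) → Tm Γ → Tm Δ
  ren r (var x)          = var (r x)
  ren r (lam t)          = lam (ren (extR r) t)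
  ren r (app t u)        = app (ren r t) (ren r u)
  ren r (dens ρ)         = dens ρ
  ren r (uni U t)        = uni U (ren r t)
  ren r (meas n t)       = meas n (ren r t)
  ren r (tens t u)       = tens (ren r t) (ren r u)
  ren r (pair le b ρ)    = pair le b ρ
  ren r (letcase m t bs) = letcase m (ren r t) (λ i → ren (extR r) (bs i))

  extS : ∀ {Γ Δ} → (Fin Γ → Tm Δ) → Fin (suc Γ) → Tm (suc Δ)
  extS s zero    = var zero
  extS s (suc i) = ren suc (s i)

  sub : ∀ {Γ Δ} → (Fin Γ → Tm Δ) → Tm Γ → Tm Δ
  sub s (var x)          = s x
  sub s (lam t)          = lam (sub (extS s) t)
  sub s (app t u)        = app (sub s t) (sub s u)
  sub s (dens ρ)         = dens ρ
  sub s (uni U t)        = uni U (sub s t)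
  sub s (meas n t)       = meas n (sub s t)
  sub s (tens t u)       = tens (sub s t) (sub s u)
  sub s (pair le b ρ)    = pair le b ρ
  sub s (letcase m t bs) = letcase m (sub s t) (λ i → sub (extS s) (bs i))

  _[_] : ∀ {Γ} → Tm (suc Γ) → Tm Γ → Tm Γ
  t [ r ] = sub (λ { zero → r ; (suc i) → var i }) t

  data Step {Γ : ℕ} : Tm Γ → Prob → Tm Γ → Set where
    β       : ∀ {t r} → Step (app (lam t) r) one (t [ r ])
    unitary : ∀ {m n} (le : m ≤ n) (U : Unit m) (ρ : Dens n) →
              Step (uni U (dens ρ)) one (dens (applyU le U ρ))
    measure-step : ∀ {m n} (le : m ≤ n) (ρ : Dens n)
              (j : Fin (suc (proj₁ (measure le ρ)))) →
              Step (meas m (dens ρ))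
                   (proj₁ (proj₂ (measure le ρ) j))
                   (pair le (proj₁ (proj₂ (proj₂ (measure le ρ) j)))
                            (proj₂ (proj₂ (proj₂ (measure le ρ) j))))
    tensor  : ∀ {n n'} (ρ : Dens n) (ρ' : Dens n') →
              Step (tens (dens ρ) (dens ρ')) one (dens (kron ρ ρ'))
    letcase-pair : ∀ {m n} (le : m ≤ n) (b : Fin (2 ^ m)) (ρ : Dens n)
              (bs : Fin (2 ^ m) → Tm (suc Γ)) →
              Step (letcase m (pair le b ρ) bs) one (bs b [ dens ρ ])
    ξ-lam   : ∀ {t t' p} → Step {suc Γ} t p t' → Step (lam t) p (lam t')
    ξ-appl  : ∀ {t t' r p} → Step t p t' → Step (app t r) p (app t' r)
    ξ-appr  : ∀ {t r r' p} → Step r p r' → Step (app t r) p (app t r')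
    ξ-uni   : ∀ {n} {U : Unit n} {t t' p} → Step t p t' →
              Step (uni U t) p (uni U t')
    ξ-meas  : ∀ {n t t' p} → Step t p t' → Step (meas n t) p (meas n t')
    ξ-tensl : ∀ {t t' r p} → Step t p t' → Step (tens t r) p (tens t' r)
    ξ-tensr : ∀ {t r r' p} → Step r p r' → Step (tens t r) p (tens t r')
    ξ-letcase : ∀ {m t t' bs p} → Step t p t' →
              Step (letcase m t bs) p (letcase m t' bs)

  data IsW {Γ : ℕ} : Tm Γ → Set
  data IsV {Γ : ℕ} : Tm Γ → Set
  data IsW {Γ} where
    w-var  : ∀ x → IsW (var x)
    w-lam  : ∀ {t} → IsV {suc Γ} t → IsW (lam t)
    w-tens : ∀ {t r} → IsW t → IsW r → IsW (tens t r)
  data IsV {Γ} where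
    v-w    : ∀ {t} → IsW t → IsV t
    v-dens : ∀ {n} (ρ : Dens n) → IsV (dens ρ)
    v-pair : ∀ {m n} (le : m ≤ n) b (ρ : Dens n) → IsV (pair le b ρ)

module LambdaRhoCirc (Q : QStruct) where
  open QStruct Q

  data Tm (Γ : ℕ) : Set where
    var     : Fin Γ → Tm Γ
    lam     : Tm (suc Γ) → Tm Γ
    app     : Tm Γ → Tm Γ → Tm Γ
    dens    : ∀ {n} → Dens n → Tm Γ
    uni     : ∀ {n} → Unit n → Tm Γ → Tm Γ
    meas    : (n : ℕ) → Tm Γ → Tm Γ
    tens    : Tm Γ → Tm Γ → Tm Γ
    letcase : (m : ℕ) → Tm Γ → (Fin (2 ^ m) → Tm (suc Γ)) → Tm Γ
    -- Σ_{i} p_i t_i with (suc k) summands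
    sum     : (k : ℕ) → (Fin (suc k) → Prob) → (Fin (suc k) → Tm Γ) → Tm Γ

  ren : ∀ {Γ Δ} → (Fin Γ → Fin Δ) → Tm Γ → Tm Δ
  ren r (var x)          = var (r x)
  ren r (lam t)          = lam (ren (extR r) t)
  ren r (app t u)        = app (ren r t) (ren r u)
  ren r (dens ρ)         = dens ρ
  ren r (uni U t)        = uni U (ren r t)
  ren r (meas n t)       = meas n (ren r t)
  ren r (tens t u)       = tens (ren r t) (ren r u)
  ren r (letcase m t bs) = letcase m (ren r t) (λ i → ren (extR r) (bs i))
  ren r (sum k ps ts)    = sum k ps (λ i → ren r (ts i))

  extS : ∀ {Γ Δ} → (Fin Γ → Tm Δ) → Fin (suc Γ) → Tm (suc Δ)
  extS s zero    = var zero
  extS s (suc i) = ren suc (s i)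

  sub : ∀ {Γ Δ} → (Fin Γ → Tm Δ) → Tm Γ → Tm Δ
  sub s (var x)          = s x
  sub s (lam t)          = lam (sub (extS s) t)
  sub s (app t u)        = app (sub s t) (sub s u)
  sub s (dens ρ)         = dens ρ
  sub s (uni U t)        = uni U (sub s t)
  sub s (meas n t)       = meas n (sub s t)
  sub s (tens t u)       = tens (sub s t) (sub s u)
  sub s (letcase m t bs) = letcase m (sub s t) (λ i → sub (extS s) (bs i))
  sub s (sum k ps ts)    = sum k ps (λ i → sub s (ts i))

  _[_] : ∀ {Γ} → Tm (suc Γ) → Tm Γ → Tm Γ
  t [ r ] = sub (λ { zero → r ; (suc i) → var i }) t

  data Step {Γ : ℕ} : Tm Γ → Tm Γ → Set where
    β       : ∀ {t r} → Step (app (lam t) r) (t [ r ])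
    letcase-meas : ∀ {m n} (le : m ≤ n) (ρ : Dens n)
              (bs : Fin (2 ^ m) → Tm (suc Γ)) →
              Step (letcase m (meas m (dens ρ)) bs)
                   (sum (proj₁ (measure le ρ))
                        (λ j → proj₁ (proj₂ (measure le ρ) j))
                        (λ j → bs (proj₁ (proj₂ (proj₂ (measure le ρ) j)))
                                  [ dens (proj₂ (proj₂ (proj₂ (measure le ρ) j))) ]))
    unitary : ∀ {m n} (le : m ≤ n) (U : Unit m) (ρ : Dens n) →
              Step (uni U (dens ρ)) (dens (applyU le U ρ))
    tensor  : ∀ {n n'} (ρ : Dens n) (ρ' : Dens n') →
              Step (tens (dens ρ) (dens ρ')) (dens (kron ρ ρ'))
    sum-dens : ∀ {n k ps ts} (ρs : Fin (suc k) → Dens n) →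
              (∀ i → ts i ≡ dens (ρs i)) →
              Step (sum k ps ts) (dens (mix ps ρs))
    sum-same : ∀ {k ps ts} (t : Tm Γ) → (∀ i → ts i ≡ t) →
              Step (sum k ps ts) t
    sum-app : ∀ {k ps ts r} →
              Step (app (sum k ps ts) r) (sum k ps (λ i → app (ts i) r))
    ξ-lam   : ∀ {t t'} → Step {suc Γ} t t' → Step (lam t) (lam t')
    ξ-appl  : ∀ {t t' r} → Step t t' → Step (app t r) (app t' r)
    ξ-appr  : ∀ {t r r'} → Step r r' → Step (app t r) (app t r')
    ξ-uni   : ∀ {n} {U : Unit n} {t t'} → Step t t' →
              Step (uni U t) (uni U t')
    ξ-meas  : ∀ {n t t'} → Step t t' → Step (meas n t) (meas n t')
    ξ-tensl : ∀ {t t' r} → Step t t' → Step (tens t r) (tens t' r)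
    ξ-tensr : ∀ {t r r'} → Step r r' → Step (tens t r) (tens t r')
    ξ-letcase : ∀ {m t t' bs} → Step t t' →
              Step (letcase m t bs) (letcase m t' bs)
    ξ-sum   : ∀ {k ps ts ts'} (j : Fin (suc k)) → Step (ts j) (ts' j) →
              (∀ i → i ≢ j → ts' i ≡ ts i) →
              Step (sum k ps ts) (sum k ps ts')

  -- ∘-values:  w ::= x | λx.v | w ⊗ w | Σ p_i w_i (w_i pairwise distinct),
  --            v ::= w | ρ^n
  -- (sums in values have at least two summands)
  data IsW {Γ : ℕ} : Tm Γ → Set
  data IsV {Γ : ℕ} : Tm Γ → Set
  data IsW {Γ} where
    w-var  : ∀ x → IsW (var x)
    w-lam  : ∀ {t} → IsV {suc Γ} t → IsW (lam t)
    w-tens : ∀ {t r} → IsW t → IsW r → IsW (tens t r)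
    w-sum  : ∀ {k ps ts} → (∀ i → IsW (ts i)) →
             (∀ i j → i ≢ j → ts i ≢ ts j) →
             IsW (sum (suc k) ps ts)
  data IsV {Γ} where
    v-w    : ∀ {t} → IsW t → IsV t
    v-dens : ∀ {n} (ρ : Dens n) → IsV (dens ρ)

module Submission where

-- In almost every case no reduction rule applies to the
-- value's head constructor, or the only applicable rule is a congruence,
-- which contradicts the induction hypothesis for the sub-value.  Two facts
-- close the remaining cases:
--   * a density-matrix constant is not a W-value, so the Kronecker-product
--     rule for ρ ⊗ ρ' (and, in λ_ρ^∘, the mixing rule for Σ p_i ρ_i) never
--     fires on a value;
--   * a family of at least two pairwise distinct elements is not constant,
--     so the rule Σ p_i t → t never fires on a value sum.

open import Defs
open import Data.Nat using (ℕ; suc)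
open import Data.Fin using (Fin; zero; suc)
open import Data.Product using (_×_; _,_)
open import Relation.Nullary using (¬_)
open import Relation.Binary.PropositionalEquality using (_≡_; _≢_; trans; sym; subst)

-- A family indexed by at least two points whose values are pairwise distinct
-- cannot be constant; this excludes the collapse rule Σ p_i t → t on values.
distinct-not-constant : ∀ {A : Set} {k : ℕ} {f : Fin (suc (suc k)) → A} →
  (∀ i j → i ≢ j → f i ≢ f j) → ∀ {x} → ¬ (∀ i → f i ≡ x)
distinct-not-constant distinct const =
  distinct zero (suc zero) (λ ()) (trans (const zero) (sym (const (suc zero))))

module ValuesOfλρ (Q : QStruct) where
  open QStruct Q using (Dens)
  open LambdaRho Q

  dens-not-W : ∀ {Γ n} {ρ : Dens n} → ¬ IsW {Γ} (dens ρ)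
  dens-not-W ()

  W-normal : ∀ {Γ} {w : Tm Γ} → IsW w → ∀ {p t} → ¬ Step w p t
  V-normal : ∀ {Γ} {v : Tm Γ} → IsV v → ∀ {p t} → ¬ Step v p t

  W-normal (w-var x)     ()
  W-normal (w-lam v)     (ξ-lam s)     = V-normal v s
  W-normal (w-tens w w') (ξ-tensl s)   = W-normal w s
  W-normal (w-tens w w') (ξ-tensr s)   = W-normal w' s
  W-normal (w-tens w w') (tensor ρ ρ') = dens-not-W w

  V-normal (v-w w)         s = W-normal w s
  V-normal (v-dens ρ)      ()
  V-normal (v-pair le b ρ) ()

module ValuesOfλρ∘ (Q : QStruct) where
  open QStruct Q using (Dens)
  open LambdaRhoCirc Q

  dens-not-W : ∀ {Γ n} {ρ : Dens n} → ¬ IsW {Γ} (dens ρ)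
  dens-not-W ()

  W-normal : ∀ {Γ} {w : Tm Γ} → IsW w → ∀ {t} → ¬ Step w t
  V-normal : ∀ {Γ} {v : Tm Γ} → IsV v → ∀ {t} → ¬ Step v t

  W-normal (w-var x)     ()
  W-normal (w-lam v)     (ξ-lam s)     = V-normal v s
  W-normal (w-tens w w') (ξ-tensl s)   = W-normal w s
  W-normal (w-tens w w') (ξ-tensr s)   = W-normal w' s
  W-normal (w-tens w w') (tensor ρ ρ') = dens-not-W w
  -- the summands of a value sum are W-values, hence not density matrices
  W-normal (w-sum ws _) (sum-dens ρs is-dens) =
    dens-not-W (subst IsW (is-dens zero) (ws zero))
  -- the summands of a value sum are pairwise distinct, hence not all equal
  W-normal (w-sum _ distinct) (sum-same t all-t) =
    distinct-not-constant distinct all-t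
  W-normal (w-sum ws _) (ξ-sum j s _) = W-normal (ws j) s

  V-normal (v-w w)    s = W-normal w s
  V-normal (v-dens ρ) ()

lemma9 : (Q : QStruct) →
    (∀ {Γ} {v : LambdaRho.Tm Q Γ} → LambdaRho.IsV Q v →
    ∀ {p} {t} → ¬ LambdaRho.Step Q v p t)
    ×
    (∀ {Γ} {v : LambdaRhoCirc.Tm Q Γ} → LambdaRhoCirc.IsV Q v →
    ∀ {t} → ¬ LambdaRhoCirc.Step Q v t)
lemma9 Q = ValuesOfλρ.V-normal Q , ValuesOfλρ∘.V-normal Q
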